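{- Let $G$ be the grid defined in the context. If two entries $G(i,j)$ and $G(i',j')$ of the grid have the same main suffix, then $i=i'$, i.e., they belong to the same row.
   Context: For a finite string $w=a_na_{n-1}\cdots a_0$ over digits $\{0,1,2\}$ let $[w]_{3/2}=\sum_k a_k(3/2)^k$. Define an operation $T$ on such strings ("adding 2 in base $\frac32$"): if $w$ contains no digit $0$, first replace $w$ by $0w$; then change the rightmost $0$ of $w$ into $2$, change every digit to the right of it by $1\mapsto0$, $2\mapsto1$, and leave all digits to the left of it unchanged. Then $[T(w)]_{3/2}=[w]_{3/2}+2$. The grid $G$ has entries $G(i,j)$ for $i,j\ge0$: $G(0,j)$ is the binary representation of $j$ (so row $0$ is $0,1,10,11,100,\dots$), and $G(i+1,j)=T(G(i,j))$; row $i$ is $\{G(i,j):j\ge0\}$. The main suffix of a string is the string obtained by deleting its maximal initial segment consisting of digits $0$ and $1$; thus the main suffix is either empty or begins with $2$. -}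

module Defs where

open import Data.Nat using (ℕ; zero; suc)
open import Data.Nat.DivMod using (_/_; _%_)
open import Data.List using (List; []; _∷_; reverse; [_]; _++_)

data Digit : Set where
  d0 d1 d2 : Digit

-- A string w = a_n a_{n-1} ... a_0 is represented as the list
-- a_n ∷ a_{n-1} ∷ ... ∷ a_0 ∷ []  (leftmost / most significant digit first).
Str : Set
Str = List Digit

-- Helper acting on the reversed string (least significant digit first):
-- decrement digits until the first (i.e. rightmost in w) 0, which becomes 2.
-- If no 0 exists, a leading 0 is prepended (it is the [] case) and becomes 2.
incrRev : List Digit → List Digit
incrRev []         = d2 ∷ []
incrRev (d0 ∷ ds)  = d2 ∷ ds
incrRev (d1 ∷ ds)  = d0 ∷ incrRev ds
incrRev (d2 ∷ ds)  = d1 ∷ incrRev ds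

-- The operation T ("adding 2 in base 3/2").
T : Str → Str
T w = reverse (incrRev (reverse w))

-- Binary digits, least significant first, computed with fuel
-- (fuel n suffices for input n since each step halves the number).
bit : ℕ → Digit
bit zero = d0
bit (suc _) = d1

binRevFuel : ℕ → ℕ → List Digit
binRevFuel zero _ = []
binRevFuel (suc f) zero = []
binRevFuel (suc f) (suc n) = bit (suc n % 2) ∷ binRevFuel f (suc n / 2)

bin : ℕ → Str
bin zero = d0 ∷ []
bin (suc n) = reverse (binRevFuel (suc n) (suc n))

iterT : ℕ → Str → Str
iterT zero w = w
iterT (suc i) w = T (iterT i w)

G : ℕ → ℕ → Str
G i j = iterT i (bin j)

mainSuffix : Str → Str
mainSuffix []        = []
mainSuffix (d0 ∷ ds) = mainSuffix ds
mainSuffix (d1 ∷ ds) = mainSuffix ds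
mainSuffix (d2 ∷ ds) = d2 ∷ ds

module Submission where

-- Idea: we attach to every string w a natural number  rank w  which
-- counts "how many times T has been applied".  It is computed by reading
-- the digits of w from the most significant one, starting from 0 and
-- updating the state n by  push d n  for every digit d, where
--   push 0 n = ⌊3n/2⌋,   push 1 n = ⌈3n/2⌉,   push 2 n = ⌊3n/2⌋ + 1.
-- Three facts make rank an exact row index:
--   * rank (T w) = rank w + 1            (T increments the rank),
--   * rank (bin j) = 0                   (row 0 has rank 0),
--   * rank (mainSuffix w) = rank w       (leading 0s and 1s act on the
--                                         state 0 and keep it 0).
-- Hence rank (mainSuffix (G i j)) = i, and equal main suffixes force
-- equal rows.  The rank is defined on reversed strings (least
-- significant digit first), the format on which T itself operates.

open import Defs
open import Data.Nat using (ℕ; zero; suc; _+_; _/_; _%_)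
open import Data.Nat.Properties using (+-identityʳ)
open import Data.List using (List; []; _∷_; reverse; foldr; foldl)
open import Data.List.Properties using (reverse-involutive; reverse-foldr)
open import Function using (flip)
open import Relation.Binary.PropositionalEquality
  using (_≡_; refl; sym; trans; cong; module ≡-Reasoning)

floor3/2 : ℕ → ℕ
floor3/2 zero          = 0
floor3/2 (suc zero)    = 1
floor3/2 (suc (suc n)) = 3 + floor3/2 n

ceil3/2 : ℕ → ℕ
ceil3/2 zero          = 0
ceil3/2 (suc zero)    = 2
ceil3/2 (suc (suc n)) = 3 + ceil3/2 n

-- The effect of appending a less significant digit on the rank.
push : Digit → ℕ → ℕ
push d0 n = floor3/2 n
push d1 n = ceil3/2 n
push d2 n = suc (floor3/2 n)

rankRev : List Digit → ℕ
rankRev = foldr push 0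

rank : Str → ℕ
rank w = rankRev (reverse w)

-- ⌊3(n+1)/2⌋ = ⌈3n/2⌉ + 1: a carry through a digit 1 turning into 0.
floor-suc : ∀ n → floor3/2 (suc n) ≡ suc (ceil3/2 n)
floor-suc zero          = refl
floor-suc (suc zero)    = refl
floor-suc (suc (suc n)) = cong (3 +_) (floor-suc n)

-- ⌈3(n+1)/2⌉ = ⌊3n/2⌋ + 2: a carry through a digit 2 turning into 1.
ceil-suc : ∀ n → ceil3/2 (suc n) ≡ suc (suc (floor3/2 n))
ceil-suc zero          = refl
ceil-suc (suc zero)    = refl
ceil-suc (suc (suc n)) = cong (3 +_) (ceil-suc n)

rankRev-incrRev : ∀ r → rankRev (incrRev r) ≡ suc (rankRev r)
rankRev-incrRev []        = refl
rankRev-incrRev (d0 ∷ ds) = refl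
rankRev-incrRev (d1 ∷ ds) = trans (cong floor3/2 (rankRev-incrRev ds)) (floor-suc (rankRev ds))
rankRev-incrRev (d2 ∷ ds) = trans (cong ceil3/2 (rankRev-incrRev ds)) (ceil-suc (rankRev ds))

rank-T : ∀ w → rank (T w) ≡ suc (rank w)
rank-T w = begin
  rankRev (reverse (reverse (incrRev (reverse w))))
    ≡⟨ cong rankRev (reverse-involutive (incrRev (reverse w))) ⟩
  rankRev (incrRev (reverse w))
    ≡⟨ rankRev-incrRev (reverse w) ⟩
  suc (rank w) ∎
  where open ≡-Reasoning

rank-iterT : ∀ i w → rank (iterT i w) ≡ i + rank w
rank-iterT zero    w = refl
rank-iterT (suc i) w = trans (rank-T (iterT i w)) (cong suc (rank-iterT i w))

-- Binary digits act trivially on the state 0, so binary strings have rank 0.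
push-bit : ∀ n → push (bit n) 0 ≡ 0
push-bit zero    = refl
push-bit (suc n) = refl

rankRev-binRevFuel : ∀ f n → rankRev (binRevFuel f n) ≡ 0
rankRev-binRevFuel zero    n       = refl
rankRev-binRevFuel (suc f) zero    = refl
rankRev-binRevFuel (suc f) (suc n) =
  trans (cong (push (bit (suc n % 2))) (rankRev-binRevFuel f (suc n / 2)))
        (push-bit (suc n % 2))

rank-bin : ∀ j → rank (bin j) ≡ 0
rank-bin zero    = refl
rank-bin (suc n) =
  trans (cong rankRev (reverse-involutive (binRevFuel (suc n) (suc n))))
        (rankRev-binRevFuel (suc n) (suc n))

-- Read from the most significant digit, the rank is a left fold from 0;
-- a leading 0 or 1 leaves the state 0 unchanged, so it does not matter.
rank-foldl : ∀ w → rank w ≡ foldl (flip push) 0 w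
rank-foldl = reverse-foldr push 0

foldl-mainSuffix : ∀ w → foldl (flip push) 0 (mainSuffix w) ≡ foldl (flip push) 0 w
foldl-mainSuffix []        = refl
foldl-mainSuffix (d0 ∷ ds) = foldl-mainSuffix ds
foldl-mainSuffix (d1 ∷ ds) = foldl-mainSuffix ds
foldl-mainSuffix (d2 ∷ ds) = refl

rank-mainSuffix : ∀ w → rank (mainSuffix w) ≡ rank w
rank-mainSuffix w = begin
  rank (mainSuffix w)               ≡⟨ rank-foldl (mainSuffix w) ⟩
  foldl (flip push) 0 (mainSuffix w) ≡⟨ foldl-mainSuffix w ⟩
  foldl (flip push) 0 w             ≡⟨ sym (rank-foldl w) ⟩
  rank w                            ∎
  where open ≡-Reasoning

rank-mainSuffix-G : ∀ i j → rank (mainSuffix (G i j)) ≡ i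
rank-mainSuffix-G i j = begin
  rank (mainSuffix (G i j)) ≡⟨ rank-mainSuffix (G i j) ⟩
  rank (iterT i (bin j))    ≡⟨ rank-iterT i (bin j) ⟩
  i + rank (bin j)          ≡⟨ cong (i +_) (rank-bin j) ⟩
  i + 0                     ≡⟨ +-identityʳ i ⟩
  i                         ∎
  where open ≡-Reasoning

lemma3 : (i j i′ j′ : ℕ) → mainSuffix (G i j) ≡ mainSuffix (G i′ j′) → i ≡ i′
lemma3 i j i′ j′ eq = begin
  i                           ≡⟨ sym (rank-mainSuffix-G i j) ⟩
  rank (mainSuffix (G i j))   ≡⟨ cong rank eq ⟩
  rank (mainSuffix (G i′ j′)) ≡⟨ rank-mainSuffix-G i′ j′ ⟩
  i′                          ∎
  where open ≡-Reasoning
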